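{- For a permutation $\pi$, let $\mathrm{lrmax}(\pi)$, $\mathrm{rlmax}(\pi)$, $\mathrm{lrmin}(\pi)$, $\mathrm{rlmin}(\pi)$ denote the numbers of left-to-right maxima, right-to-left maxima, left-to-right minima and right-to-left minima of $\pi$. Let $UD_m$ (resp. $DU_m$) be the set of up-down (resp. down-up) permutations of $\{1,\dots,m\}$. For $n\ge1$ define $F^{(1)}_{2n}(q)=\sum_{\pi\in UD_{2n}}q^{\mathrm{rlmax}(\pi)}$, $F^{(2)}_{2n-1}(q)=\sum_{\pi\in UD_{2n-1}}q^{\mathrm{rlmax}(\pi)}$, $F^{(3)}_{2n}(q)=\sum_{\pi\in DU_{2n}}q^{\mathrm{rlmax}(\pi)}$, $F^{(4)}_{2n-1}(q)=\sum_{\pi\in DU_{2n-1}}q^{\mathrm{rlmax}(\pi)}$. Then for all $n\ge1$: 1. $F^{(1)}_{2n}(q)=\sum_{\pi\in DU_{2n}}q^{\mathrm{lrmax}(\pi)}=\sum_{\pi\in DU_{2n}}q^{\mathrm{rlmin}(\pi)}=\sum_{\pi\in UD_{2n}}q^{\mathrm{lrmin}(\pi)}$; 2. $F^{(2)}_{2n-1}(q)=\sum_{\pi\in UD_{2n-1}}q^{\mathrm{lrmax}(\pi)}=\sum_{\pi\in DU_{2n-1}}q^{\mathrm{rlmin}(\pi)}=\sum_{\pi\in DU_{2n-1}}q^{\mathrm{lrmin}(\pi)}$; 3. $F^{(3)}_{2n}(q)=\sum_{\pi\in UD_{2n}}q^{\mathrm{lrmax}(\pi)}=\sum_{\pi\in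 UD_{2n}}q^{\mathrm{rlmin}(\pi)}=\sum_{\pi\in DU_{2n}}q^{\mathrm{lrmin}(\pi)}$; 4. $F^{(4)}_{2n-1}(q)=\sum_{\pi\in DU_{2n-1}}q^{\mathrm{lrmax}(\pi)}=\sum_{\pi\in UD_{2n-1}}q^{\mathrm{rlmin}(\pi)}=\sum_{\pi\in UD_{2n-1}}q^{\mathrm{lrmin}(\pi)}$.
   Context: A permutation $\pi=\pi_1\cdots\pi_m$ of $\{1,\dots,m\}$ is up-down if $\pi_1<\pi_2>\pi_3<\pi_4>\cdots$ and down-up if $\pi_1>\pi_2<\pi_3>\pi_4<\cdots$. An entry $\pi_i$ is a right-to-left maximum (resp. minimum) if it is larger (resp. smaller) than every entry to its right; left-to-right maxima/minima are defined analogously with entries to its left. In particular $\pi_m$ is always a right-to-left maximum and minimum, and $\pi_1$ is always a left-to-right maximum and minimum. -}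

module Defs where

open import Data.Nat using (ℕ; zero; suc; _+_; _^_; _<ᵇ_; _≡ᵇ_)
open import Data.Bool using (Bool; true; false; _∧_; not; if_then_else_)
open import Data.Fin using (Fin; toℕ)
open import Data.List using (List; []; _∷_; [_]; map; concatMap; filterᵇ; allFin; length)
open import Data.Bool.ListAction using (all; any)
open import Data.Nat.ListAction using (sum)
open import Data.Vec using (Vec; toList)
import Data.Vec as V

allVecs : (n k : ℕ) → List (Vec (Fin k) n)
allVecs zero    k = [ V.[] ]
allVecs (suc n) k = concatMap (λ i → map (i V.∷_) (allVecs n k)) (allFin k)

word : ∀ {n k} → Vec (Fin k) n → List ℕ
word v = map toℕ (toList v)

distinct : List ℕ → Bool
distinct []       = true
distinct (x ∷ xs) = not (any (x ≡ᵇ_) xs) ∧ distinct xs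

-- All permutations of length m, in one-line notation, with entries {0,…,m-1}
-- (order-isomorphic to {1,…,m}; all notions below depend only on relative order).
perms : ℕ → List (List ℕ)
perms m = filterᵇ distinct (map word (allVecs m m))

isUpDown isDownUp : List ℕ → Bool
isUpDown (x ∷ y ∷ rest) = (x <ᵇ y) ∧ isDownUp (y ∷ rest)
isUpDown _              = true
isDownUp (x ∷ y ∷ rest) = (y <ᵇ x) ∧ isUpDown (y ∷ rest)
isDownUp _              = true

UD DU : ℕ → List (List ℕ)
UD m = filterᵇ isUpDown (perms m)
DU m = filterᵇ isDownUp (perms m)

indicator : Bool → ℕ
indicator b = if b then 1 else 0

rlmax rlmin : List ℕ → ℕ
rlmax []       = 0
rlmax (x ∷ xs) = indicator (all (_<ᵇ x) xs) + rlmax xs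
rlmin []       = 0
rlmin (x ∷ xs) = indicator (all (x <ᵇ_) xs) + rlmin xs

lrmaxFrom lrminFrom : List ℕ → List ℕ → ℕ
lrmaxFrom seen []       = 0
lrmaxFrom seen (x ∷ xs) = indicator (all (_<ᵇ x) seen) + lrmaxFrom (x ∷ seen) xs
lrminFrom seen []       = 0
lrminFrom seen (x ∷ xs) = indicator (all (x <ᵇ_) seen) + lrminFrom (x ∷ seen) xs

lrmax lrmin : List ℕ → ℕ
lrmax = lrmaxFrom []
lrmin = lrminFrom []

GF : List (List ℕ) → (List ℕ → ℕ) → ℕ → ℕ
GF S stat q = sum (map (λ π → q ^ stat π) S)

{-# OPTIONS --safe #-}
-- Two involutions of the permutations of {0,…,m-1} do all the work. Reversal turns right-to-left
-- records into left-to-right records of the same kind; it exchanges up-down and down-up words of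
-- even length and preserves both shapes in odd length, because reading a word backwards reverses
-- the order of its m - 1 steps and flips the direction of each. Complementation x ↦ m - 1 - x turns right-to-left
-- maxima into right-to-left minima and always exchanges up-down with down-up. Transporting the
-- generating functions along reversal, complementation, or complementation followed by reversal
-- gives every identity.
module Submission where

open import Defs
open import Algebra.Bundles using (CommutativeMonoid)
import Algebra.Properties.CommutativeSemigroup as CommSemigroupProperties
open import Data.Bool using (Bool; true; false; _∧_; not; T)
open import Data.Bool.Properties using (∧-commutativeMonoid; ∧-identityʳ; not-involutive; T-∧)
open import Data.Bool.ListAction using (all; any)
open import Data.Fin using (Fin; toℕ; fromℕ<)
open import Data.Fin.Properties using (toℕ<n; toℕ-fromℕ<; toℕ-injective)
open import Data.List using (List; []; _∷_; _++_; map; length; reverse; _ʳ++_; filterᵇ; concatMap; cartesianProductWith; allFin)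
open import Data.List.Properties using (∷-injective; length-map; length-reverse; map-∘; map-id-local; reverse-involutive)
open import Data.List.Membership.Propositional using (_∈_)
open import Data.List.Membership.Propositional.Properties using (∈-map⁺; ∈-map⁻; ∈-filter⁺; ∈-filter⁻; ∈-allFin; ∈-cartesianProductWith⁺)
open import Data.List.Membership.Propositional.Properties.WithK using (unique∧set⇒bag)
open import Data.List.Relation.Binary.BagAndSetEquality using (∼bag⇒↭)
open import Data.List.Relation.Binary.Permutation.Propositional using (_↭_; ↭-sym; ↭⇒↭ₛ)
open import Data.List.Relation.Binary.Permutation.Propositional.Properties using (↭-reverse; All-resp-↭; filter-↭)
import Data.List.Relation.Binary.Permutation.Propositional.Properties as ↭
open import Data.List.Relation.Binary.Permutation.Setoid.Properties using (Unique-resp-↭)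
open import Data.List.Relation.Unary.All as All using (All; []; _∷_)
import Data.List.Relation.Unary.All.Properties as All
open import Data.List.Relation.Unary.Any using (here)
open import Data.List.Relation.Unary.AllPairs using ([]; _∷_; uncons)
open import Data.List.Relation.Unary.Unique.Propositional using (Unique)
import Data.List.Relation.Unary.Unique.Propositional.Properties as Unique
open import Data.Nat using (ℕ; zero; suc; _+_; _*_; _∸_; _^_; _<_; _≤_; _<ᵇ_; _≡ᵇ_; _<?_; s≤s)
open import Data.Nat.GeneralisedArithmetic using (iterate)
open import Data.Nat.ListAction using (sum)
open import Data.Nat.ListAction.Properties using (sum-↭)
open import Data.Nat.Properties using (+-commutativeSemigroup; +-identityʳ; *-suc; ∸-monoʳ-<; m∸n≤m; m∸[m∸n]≡n; ≡ᵇ⇒≡; ≡⇒≡ᵇ)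
open import Data.Product using (_×_; _,_; proj₁; proj₂; swap; uncurry)
open import Data.Product.Function.NonDependent.Propositional using (_×-⇔_)
open import Data.Unit using (tt)
open import Data.Vec using (Vec; toList)
import Data.Vec as Vec
import Data.Vec.Properties as Vec
open import Function using (_∘_; const; _⇔_; mk⇔; Equivalence)
import Function.Properties.Equivalence as ⇔
open import Relation.Binary.PropositionalEquality using (_≡_; _≢_; refl; sym; trans; cong; cong₂; subst; subst₂; setoid; module ≡-Reasoning)
open import Relation.Nullary.Decidable using (T?; does-⇔)

open ≡-Reasoning
open Equivalence using (to; from)
module +-Props = CommSemigroupProperties +-commutativeSemigroup
module ∧-Props = CommSemigroupProperties (CommutativeMonoid.commutativeSemigroup ∧-commutativeMonoid)


map-involutive-local : ∀ {a} {A : Set a} {f : A → A} {xs} →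
  All (λ x → f (f x) ≡ x) xs → map f (map f xs) ≡ xs
map-involutive-local {f = f} {xs} ff≡id = trans (sym (map-∘ {g = f} {f = f} xs)) (map-id-local ff≡id)

unique-map-involutive : ∀ {a} {A : Set a} {f : A → A} {xs} →
  All (λ x → f (f x) ≡ x) xs → Unique xs → Unique (map f xs)
unique-map-involutive ff≡id = Unique.map⁻ ∘ subst Unique (sym (map-involutive-local ff≡id))

map-involution-↭ : ∀ {a} {A : Set a} {f : A → A} {xs} → Unique xs →
  (∀ {x} → x ∈ xs → f x ∈ xs) → (∀ {x} → x ∈ xs → f (f x) ≡ x) → map f xs ↭ xs
map-involution-↭ {f = f} {xs} xs! closed invol = ∼bag⇒↭ (unique∧set⇒bag fxs! xs! (mk⇔ image preimage))
  where
  fxs! : Unique (map f xs)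
  fxs! = unique-map-involutive (All.tabulate invol) xs!
  image : ∀ {y} → y ∈ map f xs → y ∈ xs
  image y∈ with ∈-map⁻ f y∈
  ... | x , x∈ , refl = closed x∈
  preimage : ∀ {y} → y ∈ xs → y ∈ map f xs
  preimage y∈ = subst (_∈ map f xs) (invol y∈) (∈-map⁺ f (closed y∈))

inOrder : Bool → ℕ × ℕ → Bool
inOrder true  (x , y) = x <ᵇ y
inOrder false (x , y) = y <ᵇ x

inOrder-swap : ∀ d p → inOrder (not d) (swap p) ≡ inOrder d p
inOrder-swap true  _ = refl
inOrder-swap false _ = refl

adjacentPairs : List ℕ → List (ℕ × ℕ)
adjacentPairs (x ∷ y ∷ w) = (x , y) ∷ adjacentPairs (y ∷ w)
adjacentPairs _           = []

length-adjacentPairs : ∀ w → length (adjacentPairs w) ≡ length w ∸ 1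
length-adjacentPairs []          = refl
length-adjacentPairs (x ∷ [])    = refl
length-adjacentPairs (x ∷ y ∷ w) = cong suc (length-adjacentPairs (y ∷ w))

adjacentPairs-ʳ++ : ∀ x w s →
  adjacentPairs (w ʳ++ (x ∷ s)) ≡ map swap (adjacentPairs (x ∷ w)) ʳ++ adjacentPairs (x ∷ s)
adjacentPairs-ʳ++ x []      s = refl
adjacentPairs-ʳ++ x (y ∷ w) s = adjacentPairs-ʳ++ y w (x ∷ s)

adjacentPairs-reverse : ∀ w → adjacentPairs (reverse w) ≡ reverse (map swap (adjacentPairs w))
adjacentPairs-reverse []      = refl
adjacentPairs-reverse (x ∷ w) = adjacentPairs-ʳ++ x w []

alternatesFrom : Bool → List (ℕ × ℕ) → Bool
alternatesFrom d []       = true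
alternatesFrom d (p ∷ ps) = inOrder d p ∧ alternatesFrom (not d) ps

-- The step just before qs is the swapped head of ps; swapping flips a step's direction, so ps and
-- qs both alternate starting from d.
alternatesFrom-ʳ++ : ∀ d ps qs →
  alternatesFrom (iterate not d (length ps)) (map swap ps ʳ++ qs) ≡ alternatesFrom d ps ∧ alternatesFrom d qs
alternatesFrom-ʳ++ d []       qs = refl
alternatesFrom-ʳ++ d (p ∷ ps) qs = begin
  alternatesFrom (iterate not (not d) (length ps)) (map swap ps ʳ++ (swap p ∷ qs))
    ≡⟨ alternatesFrom-ʳ++ (not d) ps (swap p ∷ qs) ⟩
  alternatesFrom (not d) ps ∧ (inOrder (not d) (swap p) ∧ alternatesFrom (not (not d)) qs)
    ≡⟨ cong₂ (λ b e → alternatesFrom (not d) ps ∧ (b ∧ alternatesFrom e qs)) (inOrder-swap d p) (not-involutive d) ⟩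
  alternatesFrom (not d) ps ∧ (inOrder d p ∧ alternatesFrom d qs)
    ≡⟨ ∧-Props.x∙yz≈yx∙z (alternatesFrom (not d) ps) (inOrder d p) (alternatesFrom d qs) ⟩
  (inOrder d p ∧ alternatesFrom (not d) ps) ∧ alternatesFrom d qs ∎

isAlternating : Bool → List ℕ → Bool
isAlternating true  = isUpDown
isAlternating false = isDownUp

isAlternating-adjacentPairs : ∀ d w → isAlternating d w ≡ alternatesFrom d (adjacentPairs w)
isAlternating-adjacentPairs true  []          = refl
isAlternating-adjacentPairs true  (x ∷ [])    = refl
isAlternating-adjacentPairs true  (x ∷ y ∷ w) = cong ((x <ᵇ y) ∧_) (isAlternating-adjacentPairs false (y ∷ w))
isAlternating-adjacentPairs false []          = refl
isAlternating-adjacentPairs false (x ∷ [])    = refl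
isAlternating-adjacentPairs false (x ∷ y ∷ w) = cong ((y <ᵇ x) ∧_) (isAlternating-adjacentPairs true (y ∷ w))

isAlternating-reverse : ∀ d w → isAlternating (iterate not d (length w ∸ 1)) (reverse w) ≡ isAlternating d w
isAlternating-reverse d w = begin
  isAlternating (iterate not d (length w ∸ 1)) (reverse w)
    ≡⟨ isAlternating-adjacentPairs _ (reverse w) ⟩
  alternatesFrom (iterate not d (length w ∸ 1)) (adjacentPairs (reverse w))
    ≡⟨ cong₂ (λ n → alternatesFrom (iterate not d n)) (sym (length-adjacentPairs w)) (adjacentPairs-reverse w) ⟩
  alternatesFrom (iterate not d (length ps)) (map swap ps ʳ++ [])
    ≡⟨ alternatesFrom-ʳ++ d ps [] ⟩
  alternatesFrom d ps ∧ true
    ≡⟨ ∧-identityʳ _ ⟩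
  alternatesFrom d ps
    ≡⟨ isAlternating-adjacentPairs d w ⟨
  isAlternating d w ∎
  where ps = adjacentPairs w

iterate-not-even : ∀ d k → iterate not d (2 * k) ≡ d
iterate-not-even d zero    = refl
iterate-not-even d (suc k) = begin
  iterate not d (2 * suc k)          ≡⟨ cong (iterate not d) (*-suc 2 k) ⟩
  iterate not (not (not d)) (2 * k)  ≡⟨ cong (λ e → iterate not e (2 * k)) (not-involutive d) ⟩
  iterate not d (2 * k)              ≡⟨ iterate-not-even d k ⟩
  d                                  ∎

mirror : ℕ → ℕ → ℕ
mirror m x = m ∸ suc x

complement : ℕ → List ℕ → List ℕ
complement m = map (mirror m)

mirror-bounded : ∀ {m x} → x < m → mirror m x < m
mirror-bounded {suc m} {x} _ = s≤s (m∸n≤m m x)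

mirror-involutive : ∀ {m x} → x < m → mirror m (mirror m x) ≡ x
mirror-involutive {suc m} (s≤s x≤m) = m∸[m∸n]≡n x≤m

mirror-antitone : ∀ {m x y} → x < y → y < m → mirror m y < mirror m x
mirror-antitone x<y y<m = ∸-monoʳ-< (s≤s x<y) y<m

mirror-<ᵇ : ∀ {m x y} → x < m → y < m → (mirror m x <ᵇ mirror m y) ≡ (y <ᵇ x)
mirror-<ᵇ {m} {x} {y} x<m y<m =
  does-⇔ (mk⇔ reflect (λ y<x → mirror-antitone y<x x<m)) (mirror m x <? mirror m y) (y <? x)
  where
  reflect : mirror m x < mirror m y → y < x
  reflect mx<my =
    subst₂ _<_ (mirror-involutive y<m) (mirror-involutive x<m) (mirror-antitone mx<my (mirror-bounded y<m))

complement-involutive : ∀ {m w} → All (_< m) w → complement m (complement m w) ≡ w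
complement-involutive w<m = map-involutive-local (All.map mirror-involutive w<m)

isAlternating-complement : ∀ d {m w} → All (_< m) w → isAlternating (not d) (complement m w) ≡ isAlternating d w
isAlternating-complement true  []                  = refl
isAlternating-complement true  (_ ∷ [])            = refl
isAlternating-complement true  (x<m ∷ y<m ∷ w<m)   =
  cong₂ _∧_ (mirror-<ᵇ y<m x<m) (isAlternating-complement false (y<m ∷ w<m))
isAlternating-complement false []                  = refl
isAlternating-complement false (_ ∷ [])            = refl
isAlternating-complement false (x<m ∷ y<m ∷ w<m)   =
  cong₂ _∧_ (mirror-<ᵇ x<m y<m) (isAlternating-complement true (y<m ∷ w<m))

all-mirror-<ᵇ : ∀ {m x w} → x < m → All (_< m) w → all (mirror m x <ᵇ_) (complement m w) ≡ all (_<ᵇ x) w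
all-mirror-<ᵇ x<m []          = refl
all-mirror-<ᵇ x<m (y<m ∷ w<m) = cong₂ _∧_ (mirror-<ᵇ x<m y<m) (all-mirror-<ᵇ x<m w<m)

rlmin-complement : ∀ {m w} → All (_< m) w → rlmin (complement m w) ≡ rlmax w
rlmin-complement []          = refl
rlmin-complement (x<m ∷ w<m) = cong₂ _+_ (cong indicator (all-mirror-<ᵇ x<m w<m)) (rlmin-complement w<m)

rlmax-ʳ++ : ∀ w s → rlmax (w ʳ++ s) ≡ lrmaxFrom s w + rlmax s
rlmax-ʳ++ []      s = refl
rlmax-ʳ++ (x ∷ w) s = trans (rlmax-ʳ++ w (x ∷ s)) (+-Props.x∙yz≈yx∙z (lrmaxFrom (x ∷ s) w) _ (rlmax s))

rlmin-ʳ++ : ∀ w s → rlmin (w ʳ++ s) ≡ lrminFrom s w + rlmin s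
rlmin-ʳ++ []      s = refl
rlmin-ʳ++ (x ∷ w) s = trans (rlmin-ʳ++ w (x ∷ s)) (+-Props.x∙yz≈yx∙z (lrminFrom (x ∷ s) w) _ (rlmin s))

rlmax-reverse : ∀ w → rlmax (reverse w) ≡ lrmax w
rlmax-reverse w = trans (rlmax-ʳ++ w []) (+-identityʳ _)

rlmin-reverse : ∀ w → rlmin (reverse w) ≡ lrmin w
rlmin-reverse w = trans (rlmin-ʳ++ w []) (+-identityʳ _)

IsPermutation : ℕ → List ℕ → Set
IsPermutation m w = length w ≡ m × All (_< m) w × Unique w

T-not-any-≡ᵇ : ∀ x xs → T (not (any (x ≡ᵇ_) xs)) ⇔ All (x ≢_) xs
T-not-any-≡ᵇ x []       = mk⇔ (const []) (const tt)
T-not-any-≡ᵇ x (y ∷ ys) with x ≡ᵇ y in eq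
... | true  = mk⇔ (λ ()) (λ { (x≢y ∷ _) → x≢y (≡ᵇ⇒≡ x y (subst T (sym eq) tt)) })
... | false = ⇔.trans (T-not-any-≡ᵇ x ys) (mk⇔ (x≢y ∷_) All.tail)
  where
  x≢y : x ≢ y
  x≢y x≡y = subst T eq (≡⇒≡ᵇ x y x≡y)

distinct⇔Unique : ∀ w → T (distinct w) ⇔ Unique w
distinct⇔Unique []      = mk⇔ (const []) (const tt)
distinct⇔Unique (x ∷ w) =
  ⇔.trans T-∧ (⇔.trans (T-not-any-≡ᵇ x w ×-⇔ distinct⇔Unique w) (mk⇔ (uncurry _∷_) uncons))

cartesianProductWith-concatMap : ∀ {a b c} {A : Set a} {B : Set b} {C : Set c} (f : A → B → C) xs ys →
  cartesianProductWith f xs ys ≡ concatMap (λ x → map (f x) ys) xs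
cartesianProductWith-concatMap f []       ys = refl
cartesianProductWith-concatMap f (x ∷ xs) ys = cong (map (f x) ys ++_) (cartesianProductWith-concatMap f xs ys)

allVecs-suc : ∀ n k → allVecs (suc n) k ≡ cartesianProductWith Vec._∷_ (allFin k) (allVecs n k)
allVecs-suc n k = sym (cartesianProductWith-concatMap Vec._∷_ (allFin k) (allVecs n k))

allVecs-complete : ∀ {n k} (v : Vec (Fin k) n) → v ∈ allVecs n k
allVecs-complete Vec.[]      = here refl
allVecs-complete (i Vec.∷ v) =
  subst (_ ∈_) (sym (allVecs-suc _ _)) (∈-cartesianProductWith⁺ Vec._∷_ (∈-allFin i) (allVecs-complete v))

allVecs-unique : ∀ n k → Unique (allVecs n k)
allVecs-unique zero    k = [] ∷ []
allVecs-unique (suc n) k =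
  subst Unique (sym (allVecs-suc n k))
    (Unique.cartesianProductWith⁺ Vec._∷_ Vec.∷-injective (Unique.allFin⁺ k) (allVecs-unique n k))

word-length : ∀ {n k} (v : Vec (Fin k) n) → length (word v) ≡ n
word-length v = trans (length-map toℕ (toList v)) (Vec.length-toList v)

word-bounded : ∀ {n k} (v : Vec (Fin k) n) → All (_< k) (word v)
word-bounded Vec.[]      = []
word-bounded (i Vec.∷ v) = toℕ<n i ∷ word-bounded v

word-injective : ∀ {n k} {u v : Vec (Fin k) n} → word u ≡ word v → u ≡ v
word-injective {u = Vec.[]}    {Vec.[]}    _  = refl
word-injective {u = i Vec.∷ u} {j Vec.∷ v} eq =
  let i≡j , u≡v = ∷-injective eq in cong₂ Vec._∷_ (toℕ-injective i≡j) (word-injective u≡v)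

boundedVec : ∀ {k} w → All (_< k) w → Vec (Fin k) (length w)
boundedVec []      []          = Vec.[]
boundedVec (x ∷ w) (x<k ∷ w<k) = fromℕ< x<k Vec.∷ boundedVec w w<k

word-boundedVec : ∀ {k} w (w<k : All (_< k) w) → word (boundedVec w w<k) ≡ w
word-boundedVec []      []          = refl
word-boundedVec (x ∷ w) (x<k ∷ w<k) = cong₂ _∷_ (toℕ-fromℕ< x<k) (word-boundedVec w w<k)

∈-perms⁻ : ∀ {m w} → w ∈ perms m → IsPermutation m w
∈-perms⁻ {m} w∈ with ∈-filter⁻ (T? ∘ distinct) {xs = map word (allVecs m m)} w∈
... | w∈words , distinct-w with ∈-map⁻ word w∈words
... | v , _ , refl = word-length v , word-bounded v , to (distinct⇔Unique (word v)) distinct-w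

∈-perms⁺ : ∀ {m w} → IsPermutation m w → w ∈ perms m
∈-perms⁺ {w = w} (refl , w<m , w!) = ∈-filter⁺ (T? ∘ distinct) w∈words (from (distinct⇔Unique w) w!)
  where
  w∈words : w ∈ map word (allVecs (length w) (length w))
  w∈words = subst (_∈ _) (word-boundedVec w w<m) (∈-map⁺ word (allVecs-complete (boundedVec w w<m)))

perms-unique : ∀ m → Unique (perms m)
perms-unique m = Unique.filter⁺ (T? ∘ distinct) (Unique.map⁺ word-injective (allVecs-unique m m))

reverse-IsPermutation : ∀ {m w} → IsPermutation m w → IsPermutation m (reverse w)
reverse-IsPermutation {w = w} (len , w<m , w!) =
  trans (length-reverse w) len ,
  All-resp-↭ (↭-sym (↭-reverse w)) w<m ,
  Unique-resp-↭ (setoid ℕ) (↭⇒↭ₛ (↭-sym (↭-reverse w))) w!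

complement-IsPermutation : ∀ {m w} → IsPermutation m w → IsPermutation m (complement m w)
complement-IsPermutation {m} {w} (len , w<m , w!) =
  trans (length-map (mirror m) w) len ,
  All.map⁺ (All.map mirror-bounded w<m) ,
  unique-map-involutive (All.map mirror-involutive w<m) w!

filterᵇ-map : ∀ {a b} {A : Set a} {B : Set b} (P : B → Bool) (f : A → B) xs →
  filterᵇ P (map f xs) ≡ map f (filterᵇ (P ∘ f) xs)
filterᵇ-map P f []       = refl
filterᵇ-map P f (x ∷ xs) with P (f x)
... | true  = cong (f x ∷_) (filterᵇ-map P f xs)
... | false = filterᵇ-map P f xs

GF-filterᵇ-cong : ∀ q {S : List (List ℕ)} {P P′ : List ℕ → Bool} {s s′ : List ℕ → ℕ} →
  All (λ w → P w ≡ P′ w × s w ≡ s′ w) S → GF (filterᵇ P S) s q ≡ GF (filterᵇ P′ S) s′ q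
GF-filterᵇ-cong q [] = refl
GF-filterᵇ-cong q {w ∷ S} {P} {P′} ((P≡P′ , s≡s′) ∷ rest) with P w | P′ w | P≡P′
... | true  | .true  | refl = cong₂ _+_ (cong (q ^_) s≡s′) (GF-filterᵇ-cong q rest)
... | false | .false | refl = GF-filterᵇ-cong q rest

GF-involution : ∀ q {S : List (List ℕ)} {f : List ℕ → List ℕ} {P P′ : List ℕ → Bool} {s s′ : List ℕ → ℕ} →
  Unique S → (∀ {w} → w ∈ S → f w ∈ S) → (∀ {w} → w ∈ S → f (f w) ≡ w) →
  (∀ {w} → w ∈ S → P′ (f w) ≡ P w) → (∀ {w} → w ∈ S → s′ (f w) ≡ s w) →
  GF (filterᵇ P S) s q ≡ GF (filterᵇ P′ S) s′ q
GF-involution q {S} {f} {P} {P′} {s} {s′} S! closed invol f-P f-s = begin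
  GF (filterᵇ P S) s q
    ≡⟨ GF-filterᵇ-cong q {s′ = s′ ∘ f} (All.tabulate (λ w∈ → sym (f-P w∈) , sym (f-s w∈))) ⟩
  GF (filterᵇ (P′ ∘ f) S) (s′ ∘ f) q
    ≡⟨ cong sum (map-∘ (filterᵇ (P′ ∘ f) S)) ⟩
  sum (map (λ π → q ^ s′ π) (map f (filterᵇ (P′ ∘ f) S)))
    ≡⟨ cong (λ ws → GF ws s′ q) (filterᵇ-map P′ f S) ⟨
  GF (filterᵇ P′ (map f S)) s′ q
    ≡⟨ sum-↭ (↭.map⁺ _ (filter-↭ (T? ∘ P′) (map-involution-↭ S! closed invol))) ⟩
  GF (filterᵇ P′ S) s′ q ∎

GF-perms-involution : ∀ m q {f : List ℕ → List ℕ} {P P′ : List ℕ → Bool} {s s′ : List ℕ → ℕ} →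
  (∀ {w} → IsPermutation m w → IsPermutation m (f w)) → (∀ {w} → IsPermutation m w → f (f w) ≡ w) →
  (∀ {w} → IsPermutation m w → P′ (f w) ≡ P w) → (∀ {w} → IsPermutation m w → s′ (f w) ≡ s w) →
  GF (filterᵇ P (perms m)) s q ≡ GF (filterᵇ P′ (perms m)) s′ q
GF-perms-involution m q {s = s} {s′} closed invol f-P f-s =
  GF-involution q {s = s} {s′} (perms-unique m) (λ w∈ → ∈-perms⁺ (closed (∈-perms⁻ w∈)))
    (λ w∈ → invol (∈-perms⁻ w∈)) (λ w∈ → f-P (∈-perms⁻ w∈)) (λ w∈ → f-s (∈-perms⁻ w∈))

Alternating : Bool → ℕ → List (List ℕ)
Alternating d m = filterᵇ (isAlternating d) (perms m)

GF-complement : ∀ d m q → GF (Alternating d m) rlmax q ≡ GF (Alternating (not d) m) rlmin q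
GF-complement d m q = GF-perms-involution m q {s = rlmax} {s′ = rlmin} complement-IsPermutation
  (complement-involutive ∘ bounded) (isAlternating-complement d ∘ bounded) (rlmin-complement ∘ bounded)
  where
  bounded : ∀ {w} → IsPermutation m w → All (_< m) w
  bounded = proj₁ ∘ proj₂

GF-reverse : ∀ d m q (s s′ : List ℕ → ℕ) → (∀ w → s′ (reverse w) ≡ s w) →
  GF (Alternating d m) s q ≡ GF (Alternating (iterate not d (m ∸ 1)) m) s′ q
GF-reverse d m q s s′ reverse-s =
  GF-perms-involution m q {s = s} {s′ = s′} reverse-IsPermutation (λ _ → reverse-involutive _)
    reverse-isAlternating (λ _ → reverse-s _)
  where
  reverse-isAlternating : ∀ {w} → IsPermutation m w →
    isAlternating (iterate not d (m ∸ 1)) (reverse w) ≡ isAlternating d w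
  reverse-isAlternating {w} (len , _) =
    subst (λ n → isAlternating (iterate not d (n ∸ 1)) (reverse w) ≡ isAlternating d w) len
      (isAlternating-reverse d w)

GF-reverse-even : ∀ k d q (s s′ : List ℕ → ℕ) → (∀ w → s′ (reverse w) ≡ s w) →
  GF (Alternating d (2 * suc k)) s q ≡ GF (Alternating (not d) (2 * suc k)) s′ q
GF-reverse-even k d q s s′ reverse-s =
  trans (GF-reverse d (2 * suc k) q s s′ reverse-s)
    (cong (λ e → GF (Alternating e (2 * suc k)) s′ q) direction)
  where
  direction : iterate not d (2 * suc k ∸ 1) ≡ not d
  direction = trans (cong (iterate not d ∘ (_∸ 1)) (*-suc 2 k)) (iterate-not-even (not d) k)

GF-reverse-odd : ∀ k d q (s s′ : List ℕ → ℕ) → (∀ w → s′ (reverse w) ≡ s w) →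
  GF (Alternating d (2 * suc k ∸ 1)) s q ≡ GF (Alternating d (2 * suc k ∸ 1)) s′ q
GF-reverse-odd k d q s s′ reverse-s =
  trans (GF-reverse d (2 * suc k ∸ 1) q s s′ reverse-s)
    (cong (λ e → GF (Alternating e (2 * suc k ∸ 1)) s′ q) direction)
  where
  direction : iterate not d (2 * suc k ∸ 1 ∸ 1) ≡ d
  direction = trans (cong (iterate not d ∘ (_∸ 2)) (*-suc 2 k)) (iterate-not-even d k)

proposition1 : (n : ℕ) → 1 ≤ n → (q : ℕ) →
    (GF (UD (2 * n)) rlmax q ≡ GF (DU (2 * n)) lrmax q
      × GF (UD (2 * n)) rlmax q ≡ GF (DU (2 * n)) rlmin q
      × GF (UD (2 * n)) rlmax q ≡ GF (UD (2 * n)) lrmin q)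
    × (GF (UD (2 * n ∸ 1)) rlmax q ≡ GF (UD (2 * n ∸ 1)) lrmax q
      × GF (UD (2 * n ∸ 1)) rlmax q ≡ GF (DU (2 * n ∸ 1)) rlmin q
      × GF (UD (2 * n ∸ 1)) rlmax q ≡ GF (DU (2 * n ∸ 1)) lrmin q)
    × (GF (DU (2 * n)) rlmax q ≡ GF (UD (2 * n)) lrmax q
      × GF (DU (2 * n)) rlmax q ≡ GF (UD (2 * n)) rlmin q
      × GF (DU (2 * n)) rlmax q ≡ GF (DU (2 * n)) lrmin q)
    × (GF (DU (2 * n ∸ 1)) rlmax q ≡ GF (DU (2 * n ∸ 1)) lrmax q
      × GF (DU (2 * n ∸ 1)) rlmax q ≡ GF (UD (2 * n ∸ 1)) rlmin q
      × GF (DU (2 * n ∸ 1)) rlmax q ≡ GF (UD (2 * n ∸ 1)) lrmin q)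
proposition1 (suc k) _ q =
    ( sym (GF-reverse-even k false q lrmax rlmax rlmax-reverse)
    , GF-complement true even q
    , trans (GF-complement true even q) (sym (GF-reverse-even k true q lrmin rlmin rlmin-reverse)))
  , ( sym (GF-reverse-odd k true q lrmax rlmax rlmax-reverse)
    , GF-complement true odd q
    , trans (GF-complement true odd q) (sym (GF-reverse-odd k false q lrmin rlmin rlmin-reverse)))
  , ( sym (GF-reverse-even k true q lrmax rlmax rlmax-reverse)
    , GF-complement false even q
    , trans (GF-complement false even q) (sym (GF-reverse-even k false q lrmin rlmin rlmin-reverse)))
  , ( sym (GF-reverse-odd k false q lrmax rlmax rlmax-reverse)
    , GF-complement false odd q
    , trans (GF-complement false odd q) (sym (GF-reverse-odd k true q lrmin rlmin rlmin-reverse)))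
  where
  even odd : ℕ
  even = 2 * suc k
  odd  = 2 * suc k ∸ 1
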